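{- Let $\mathbf U=\langle\langle U,\approx\rangle,\preceq\rangle$ be a completely lattice $\mathbf L$-ordered set. Then the $\mathbf L$-relations $\preceq$ and $\approx$ on $\mathbf U$ are complete.
   Context: $\mathbf L=\langle L,\wedge,\vee,\otimes,\to,0,1\rangle$ is a complete residuated lattice ($\langle L,\wedge,\vee,0,1\rangle$ complete lattice, $\langle L,\otimes,1\rangle$ commutative monoid, $a\otimes b\le c$ iff $a\le b\to c$). An $\mathbf L$-set in $X$ is a map $X\to L$; $L^X$ the set of them; $S(A,B)=\bigwedge_x(A(x)\to B(x))$. An $\mathbf L$-equality is a binary $\mathbf L$-relation that is reflexive, symmetric, transitive ($R(x,y)\otimes R(y,z)\le R(x,z)$) and with $R(x,y)=1\Rightarrow x=y$. An $\mathbf L$-ordered set is $\langle\langle U,\approx\rangle,\preceq\rangle$, $\approx$ an $\mathbf L$-equality, $\preceq$ reflexive, transitive, compatible with $\approx$ ($(u\preceq v)\otimes(u\approx u')\otimes(v\approx v')\le(u'\preceq v')$), and $(u\preceq v)\wedge(v\preceq u)\le u\approx v$. For $V\in L^U$: $\mathcal L V(v)=\bigwedge_u(V(u)\to(v\preceq u))$, $\mathcal U V(v)=\bigwedge_u(V(u)\to(u\preceq v))$; $\inf V$ is the unique $u$ with $\mathcal L V(u)=1=\mathcal U(\mathcal L V)(u)$, $\sup V$ the unique $u$ with $\mathcal U V(u)=1=\mathcal L(\mathcal U V)(u)$; completely lattice means these exist for all $V$. Power relation: for $R$ on $X$ and $A,B\in L^X$, $(R\circ B)(x)=\bigvee_y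 R(x,y)\otimes B(y)$, $(A\circ R)(y)=\bigvee_x A(x)\otimes R(x,y)$, $R^+(A,B)=S(A,R\circ B)\wedge S(B,A\circ R)$. A binary $\mathbf L$-relation $R$ on $\mathbf U$ is complete if it is compatible with $\approx$ (i.e. $R(u,v)\otimes(u\approx u')\otimes(v\approx v')\le R(u',v')$) and for all $V_1,V_2\in L^U$, $R^+(V_1,V_2)\le R(\inf V_1,\inf V_2)$ and $R^+(V_1,V_2)\le R(\sup V_1,\sup V_2)$. -}

module Defs where

open import Level using (Level; suc)
open import Data.Product using (Σ; _×_; _,_)
open import Relation.Binary.PropositionalEquality using (_≡_)

-- Elements compared by _≡_; complete means
-- arbitrary infima/suprema of families indexed by any type in Set ℓ
-- (in particular every subset of L, which is indexed by L itself).
record CompleteResiduatedLattice (ℓ : Level) : Set (suc ℓ) where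
  infixr 7 _⊗_
  infixr 6 _∧_
  infixr 5 _∨_
  infixr 4 _⇒_
  infix 3 _≤_
  field
    Carrier : Set ℓ
    _≤_ : Carrier → Carrier → Set ℓ
    ≤-refl : ∀ {a} → a ≤ a
    ≤-trans : ∀ {a b c} → a ≤ b → b ≤ c → a ≤ c
    ≤-antisym : ∀ {a b} → a ≤ b → b ≤ a → a ≡ b
    ⋀ : {I : Set ℓ} → (I → Carrier) → Carrier
    ⋀-lb : ∀ {I : Set ℓ} (f : I → Carrier) (i : I) → ⋀ f ≤ f i
    ⋀-glb : ∀ {I : Set ℓ} (f : I → Carrier) (c : Carrier) → (∀ i → c ≤ f i) → c ≤ ⋀ f
    ⋁ : {I : Set ℓ} → (I → Carrier) → Carrier
    ⋁-ub : ∀ {I : Set ℓ} (f : I → Carrier) (i : I) → f i ≤ ⋁ f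
    ⋁-lub : ∀ {I : Set ℓ} (f : I → Carrier) (c : Carrier) → (∀ i → f i ≤ c) → ⋁ f ≤ c
    _∧_ : Carrier → Carrier → Carrier
    ∧-lb₁ : ∀ a b → a ∧ b ≤ a
    ∧-lb₂ : ∀ a b → a ∧ b ≤ b
    ∧-glb : ∀ a b c → c ≤ a → c ≤ b → c ≤ a ∧ b
    _∨_ : Carrier → Carrier → Carrier
    ∨-ub₁ : ∀ a b → a ≤ a ∨ b
    ∨-ub₂ : ∀ a b → b ≤ a ∨ b
    ∨-lub : ∀ a b c → a ≤ c → b ≤ c → a ∨ b ≤ c
    𝟘 : Carrier
    𝟙 : Carrier
    𝟘-least : ∀ a → 𝟘 ≤ a
    𝟙-greatest : ∀ a → a ≤ 𝟙
    _⊗_ : Carrier → Carrier → Carrier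
    ⊗-assoc : ∀ a b c → (a ⊗ b) ⊗ c ≡ a ⊗ (b ⊗ c)
    ⊗-comm : ∀ a b → a ⊗ b ≡ b ⊗ a
    ⊗-identityʳ : ∀ a → a ⊗ 𝟙 ≡ a
    _⇒_ : Carrier → Carrier → Carrier
    adj₁ : ∀ {a b c} → a ⊗ b ≤ c → a ≤ b ⇒ c
    adj₂ : ∀ {a b c} → a ≤ b ⇒ c → a ⊗ b ≤ c

module _ {ℓ : Level} (𝐋 : CompleteResiduatedLattice ℓ) where
  open CompleteResiduatedLattice 𝐋

  LSet : Set ℓ → Set ℓ
  LSet X = X → Carrier

  LRel : Set ℓ → Set ℓ
  LRel X = X → X → Carrier

  S : {X : Set ℓ} → LSet X → LSet X → Carrier
  S A B = ⋀ (λ x → A x ⇒ B x)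

  Reflexive : {X : Set ℓ} → LRel X → Set ℓ
  Reflexive R = ∀ x → R x x ≡ 𝟙

  Symmetric : {X : Set ℓ} → LRel X → Set ℓ
  Symmetric R = ∀ x y → R x y ≡ R y x

  Transitive : {X : Set ℓ} → LRel X → Set ℓ
  Transitive R = ∀ x y z → R x y ⊗ R y z ≤ R x z

  record IsLEquality {X : Set ℓ} (E : LRel X) : Set ℓ where
    field
      refl  : Reflexive E
      sym   : Symmetric E
      trans : Transitive E
      sep   : ∀ x y → E x y ≡ 𝟙 → x ≡ y

  Compatible : {X : Set ℓ} → LRel X → LRel X → Set ℓ
  Compatible ≈ R = ∀ u v u' v' → R u v ⊗ ≈ u u' ⊗ ≈ v v' ≤ R u' v'

  record IsLOrderedSet {U : Set ℓ} (≈ ≼ : LRel U) : Set ℓ where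
    field
      isLEquality : IsLEquality ≈
      ≼-refl      : Reflexive ≼
      ≼-trans     : Transitive ≼
      ≼-compat    : Compatible ≈ ≼
      ≼-antisym   : ∀ u v → ≼ u v ∧ ≼ v u ≤ ≈ u v

  module _ {U : Set ℓ} (≼ : LRel U) where
    𝓛 : LSet U → LSet U
    𝓛 V v = ⋀ (λ u → V u ⇒ ≼ v u)

    𝓤 : LSet U → LSet U
    𝓤 V v = ⋀ (λ u → V u ⇒ ≼ u v)

    IsInf : LSet U → U → Set ℓ
    IsInf V u = (𝓛 V u ≡ 𝟙) × (𝓤 (𝓛 V) u ≡ 𝟙)

    IsSup : LSet U → U → Set ℓ
    IsSup V u = (𝓤 V u ≡ 𝟙) × (𝓛 (𝓤 V) u ≡ 𝟙)

    CompletelyLattice : Set ℓ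
    CompletelyLattice =
      (∀ (V : LSet U) → Σ U (λ u → IsInf V u × (∀ u' → IsInf V u' → u' ≡ u)))
      × (∀ (V : LSet U) → Σ U (λ u → IsSup V u × (∀ u' → IsSup V u' → u' ≡ u)))

  _∘ʳ_ : {X : Set ℓ} → LRel X → LSet X → LSet X
  (R ∘ʳ B) x = ⋁ (λ y → R x y ⊗ B y)

  _ˡ∘_ : {X : Set ℓ} → LSet X → LRel X → LSet X
  (A ˡ∘ R) y = ⋁ (λ x → A x ⊗ R x y)

  _⁺ : {X : Set ℓ} → LRel X → LSet X → LSet X → Carrier
  (R ⁺) A B = S A (R ∘ʳ B) ∧ S B (A ˡ∘ R)

  -- complete L-relation on the L-ordered set ⟨⟨U,≈⟩,≼⟩; inf/sup are
  -- referred to through IsInf/IsSup (they are unique when they exist)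
  IsCompleteRel : {U : Set ℓ} (≈ ≼ R : LRel U) → Set ℓ
  IsCompleteRel {U} ≈ ≼ R =
    Compatible ≈ R
    × (∀ (V₁ V₂ : LSet U) (u₁ u₂ : U) → IsInf ≼ V₁ u₁ → IsInf ≼ V₂ u₂ →
         (R ⁺) V₁ V₂ ≤ R u₁ u₂)
    × (∀ (V₁ V₂ : LSet U) (u₁ u₂ : U) → IsSup ≼ V₁ u₁ → IsSup ≼ V₂ u₂ →
         (R ⁺) V₁ V₂ ≤ R u₁ u₂)

-- Transitivity of ≼ shows that V₂ ⊆ V₁ ∘ ≼ makes every lower bound of V₁ a
-- lower bound of V₂, so the degree of this inclusion bounds inf V₁ ≼ inf V₂;
-- dually V₁ ⊆ ≼ ∘ V₂ bounds sup V₁ ≼ sup V₂.  These are the two halves of ≼⁺,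
-- so ≼ is complete.  Since ≈ is symmetric and contained in ≼, ≈⁺(V₁,V₂) is
-- below both ≼⁺(V₁,V₂) and ≼⁺(V₂,V₁), and antisymmetry turns the resulting
-- bounds u₁ ≼ u₂ and u₂ ≼ u₁ into u₁ ≈ u₂.
module Submission where

open import Defs
open import Level using (Level)
open import Data.Product using (_×_; _,_)
open import Relation.Binary.Bundles using (Poset)
open import Relation.Binary.PropositionalEquality as ≡ using (_≡_)
import Relation.Binary.Reasoning.PartialOrder as PartialOrderReasoning

module ResiduatedLatticeProperties {ℓ : Level} (𝐋 : CompleteResiduatedLattice ℓ) where
  open CompleteResiduatedLattice 𝐋

  poset : Poset ℓ ℓ ℓ
  poset = record
    { Carrier = Carrier
    ; _≈_ = _≡_
    ; _≤_ = _≤_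
    ; isPartialOrder = record
      { isPreorder = record
        { isEquivalence = ≡.isEquivalence
        ; reflexive = λ { ≡.refl → ≤-refl }
        ; trans = ≤-trans
        }
      ; antisym = ≤-antisym
      }
    }

  open PartialOrderReasoning poset public

  ≡⇒≤ : ∀ {a b} → a ≡ b → a ≤ b
  ≡⇒≤ ≡.refl = ≤-refl

  ⊗-identityˡ : ∀ a → 𝟙 ⊗ a ≡ a
  ⊗-identityˡ a = ≡.trans (⊗-comm 𝟙 a) (⊗-identityʳ a)

  ⊗-monoˡ : ∀ {a b} c → a ≤ b → a ⊗ c ≤ b ⊗ c
  ⊗-monoˡ c a≤b = adj₂ (≤-trans a≤b (adj₁ ≤-refl))

  ⊗-monoʳ : ∀ {a b} c → a ≤ b → c ⊗ a ≤ c ⊗ b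
  ⊗-monoʳ {a} {b} c a≤b = begin
    c ⊗ a  ≡⟨ ⊗-comm c a ⟩
    a ⊗ c  ≤⟨ ⊗-monoˡ c a≤b ⟩
    b ⊗ c  ≡⟨ ⊗-comm b c ⟩
    c ⊗ b  ∎

  ∧-mono : ∀ {a b c d} → a ≤ b → c ≤ d → a ∧ c ≤ b ∧ d
  ∧-mono a≤b c≤d =
    ∧-glb _ _ _ (≤-trans (∧-lb₁ _ _) a≤b) (≤-trans (∧-lb₂ _ _) c≤d)

  ⋁-mono : ∀ {I : Set ℓ} {f g : I → Carrier} → (∀ i → f i ≤ g i) → ⋁ f ≤ ⋁ g
  ⋁-mono {g = g} f≤g = ⋁-lub _ (⋁ g) (λ i → ≤-trans (f≤g i) (⋁-ub g i))

  module _ {X : Set ℓ} where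

    ≤-S⇒⊗≤ : ∀ {a} {A B : LSet 𝐋 X} → a ≤ S 𝐋 A B → ∀ x → a ⊗ A x ≤ B x
    ≤-S⇒⊗≤ a≤S x = adj₂ (≤-trans a≤S (⋀-lb _ x))

    S≡𝟙⇒⊆ : ∀ {A B : LSet 𝐋 X} → S 𝐋 A B ≡ 𝟙 → ∀ x → A x ≤ B x
    S≡𝟙⇒⊆ {A} {B} S≡𝟙 x = begin
      A x          ≡⟨ ≡.sym (⊗-identityˡ (A x)) ⟩
      𝟙 ⊗ A x      ≤⟨ ≤-S⇒⊗≤ (≡⇒≤ (≡.sym S≡𝟙)) x ⟩
      B x          ∎

    S-monoʳ : ∀ {A B B' : LSet 𝐋 X} → (∀ x → B x ≤ B' x) → S 𝐋 A B ≤ S 𝐋 A B'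
    S-monoʳ B≤B' = ⋀-glb _ _ (λ x → adj₁ (≤-trans (≤-S⇒⊗≤ ≤-refl x) (B≤B' x)))

    ⁺-mono : ∀ {R R' : LRel 𝐋 X} → (∀ x y → R x y ≤ R' x y) →
             ∀ A B → _⁺ 𝐋 R A B ≤ _⁺ 𝐋 R' A B
    ⁺-mono R≤R' A B = ∧-mono
      (S-monoʳ (λ x → ⋁-mono (λ y → ⊗-monoˡ (B y) (R≤R' x y))))
      (S-monoʳ (λ y → ⋁-mono (λ x → ⊗-monoʳ (A x) (R≤R' x y))))

    ⁺-flip : ∀ {R R' : LRel 𝐋 X} → (∀ x y → R x y ≤ R' y x) →
             ∀ A B → _⁺ 𝐋 R A B ≤ _⁺ 𝐋 R' B A
    ⁺-flip {R} {R'} R≤R'ᵀ A B = ∧-glb _ _ _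
      (≤-trans (∧-lb₂ _ _) (S-monoʳ (λ y → ⋁-mono (λ x → begin
        A x ⊗ R x y    ≡⟨ ⊗-comm (A x) (R x y) ⟩
        R x y ⊗ A x    ≤⟨ ⊗-monoˡ (A x) (R≤R'ᵀ x y) ⟩
        R' y x ⊗ A x   ∎))))
      (≤-trans (∧-lb₁ _ _) (S-monoʳ (λ x → ⋁-mono (λ y → begin
        R x y ⊗ B y    ≡⟨ ⊗-comm (R x y) (B y) ⟩
        B y ⊗ R x y    ≤⟨ ⊗-monoʳ (B y) (R≤R'ᵀ x y) ⟩
        B y ⊗ R' y x   ∎))))

module LOrderedSetProperties {ℓ : Level} (𝐋 : CompleteResiduatedLattice ℓ) {U : Set ℓ}
    (≈ ≼ : LRel 𝐋 U) (isLOrderedSet : IsLOrderedSet 𝐋 ≈ ≼) where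
  open CompleteResiduatedLattice 𝐋
  open ResiduatedLatticeProperties 𝐋
  open IsLOrderedSet isLOrderedSet
  module ≈ = IsLEquality isLEquality

  ≈-compat : Compatible 𝐋 ≈ ≈
  ≈-compat u v u' v' = begin
    ≈ u v ⊗ ≈ u u' ⊗ ≈ v v'      ≡⟨ ≡.sym (⊗-assoc (≈ u v) (≈ u u') (≈ v v')) ⟩
    (≈ u v ⊗ ≈ u u') ⊗ ≈ v v'    ≡⟨ ≡.cong (_⊗ ≈ v v') (⊗-comm (≈ u v) (≈ u u')) ⟩
    (≈ u u' ⊗ ≈ u v) ⊗ ≈ v v'    ≡⟨ ≡.cong (λ a → (a ⊗ ≈ u v) ⊗ ≈ v v') (≈.sym u u') ⟩
    (≈ u' u ⊗ ≈ u v) ⊗ ≈ v v'    ≤⟨ ⊗-monoˡ (≈ v v') (≈.trans u' u v) ⟩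
    ≈ u' v ⊗ ≈ v v'              ≤⟨ ≈.trans u' v v' ⟩
    ≈ u' v'                      ∎

  ≈⇒≼ : ∀ x y → ≈ x y ≤ ≼ x y
  ≈⇒≼ x y = begin
    ≈ x y                        ≡⟨ ≡.sym (≡.trans (⊗-identityˡ _) (⊗-identityˡ _)) ⟩
    𝟙 ⊗ 𝟙 ⊗ ≈ x y                ≡⟨ ≡.cong₂ (λ a b → a ⊗ b ⊗ ≈ x y) (≡.sym (≼-refl x)) (≡.sym (≈.refl x)) ⟩
    ≼ x x ⊗ ≈ x x ⊗ ≈ x y        ≤⟨ ≼-compat x x x y ⟩
    ≼ x y                        ∎

  ≈⇒≽ : ∀ x y → ≈ x y ≤ ≼ y x
  ≈⇒≽ x y = ≤-trans (≡⇒≤ (≈.sym x y)) (≈⇒≼ y x)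

  lowerBound-ˡ∘ : ∀ {V u} → 𝓛 𝐋 ≼ V u ≡ 𝟙 → ∀ y → _ˡ∘_ 𝐋 V ≼ y ≤ ≼ u y
  lowerBound-ˡ∘ {V} {u} u≤V y = ⋁-lub _ _ (λ x → begin
    V x ⊗ ≼ x y      ≤⟨ ⊗-monoˡ (≼ x y) (S≡𝟙⇒⊆ u≤V x) ⟩
    ≼ u x ⊗ ≼ x y    ≤⟨ ≼-trans u x y ⟩
    ≼ u y            ∎)

  upperBound-∘ʳ : ∀ {V u} → 𝓤 𝐋 ≼ V u ≡ 𝟙 → ∀ x → _∘ʳ_ 𝐋 ≼ V x ≤ ≼ x u
  upperBound-∘ʳ {V} {u} V≤u x = ⋁-lub _ _ (λ y → begin
    ≼ x y ⊗ V y      ≤⟨ ⊗-monoʳ (≼ x y) (S≡𝟙⇒⊆ V≤u y) ⟩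
    ≼ x y ⊗ ≼ y u    ≤⟨ ≼-trans x y u ⟩
    ≼ x u            ∎)

  inf-mono : ∀ {V₁ V₂ u₁ u₂} → IsInf 𝐋 ≼ V₁ u₁ → IsInf 𝐋 ≼ V₂ u₂ →
             S 𝐋 V₂ (_ˡ∘_ 𝐋 V₁ ≼) ≤ ≼ u₁ u₂
  inf-mono {V₂ = V₂} {u₁} (u₁≤V₁ , _) (_ , 𝓛V₂≤u₂) = begin
    S 𝐋 V₂ (_ˡ∘_ 𝐋 _ ≼)   ≤⟨ S-monoʳ (lowerBound-ˡ∘ u₁≤V₁) ⟩
    𝓛 𝐋 ≼ V₂ u₁           ≤⟨ S≡𝟙⇒⊆ 𝓛V₂≤u₂ u₁ ⟩
    ≼ u₁ _                ∎

  sup-mono : ∀ {V₁ V₂ u₁ u₂} → IsSup 𝐋 ≼ V₁ u₁ → IsSup 𝐋 ≼ V₂ u₂ →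
             S 𝐋 V₁ (_∘ʳ_ 𝐋 ≼ V₂) ≤ ≼ u₁ u₂
  sup-mono {V₁} {u₂ = u₂} (_ , u₁≤𝓤V₁) (V₂≤u₂ , _) = begin
    S 𝐋 V₁ (_∘ʳ_ 𝐋 ≼ _)   ≤⟨ S-monoʳ (upperBound-∘ʳ V₂≤u₂) ⟩
    𝓤 𝐋 ≼ V₁ u₂           ≤⟨ S≡𝟙⇒⊆ u₁≤𝓤V₁ u₂ ⟩
    ≼ _ u₂                ∎

  ⁺-Bounds : (LSet 𝐋 U → U → Set ℓ) → LRel 𝐋 U → Set ℓ
  ⁺-Bounds IsBound R = ∀ V₁ V₂ u₁ u₂ → IsBound V₁ u₁ → IsBound V₂ u₂ →
                       _⁺ 𝐋 R V₁ V₂ ≤ R u₁ u₂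

  ≼-⁺-Bounds⇒≈-⁺-Bounds : ∀ {IsBound} → ⁺-Bounds IsBound ≼ → ⁺-Bounds IsBound ≈
  ≼-⁺-Bounds⇒≈-⁺-Bounds ≼-bounds V₁ V₂ u₁ u₂ b₁ b₂ = begin
    _⁺ 𝐋 ≈ V₁ V₂                   ≤⟨ ∧-glb _ _ _ (⁺-mono ≈⇒≼ V₁ V₂) (⁺-flip ≈⇒≽ V₁ V₂) ⟩
    _⁺ 𝐋 ≼ V₁ V₂ ∧ _⁺ 𝐋 ≼ V₂ V₁    ≤⟨ ∧-mono (≼-bounds V₁ V₂ u₁ u₂ b₁ b₂)
                                               (≼-bounds V₂ V₁ u₂ u₁ b₂ b₁) ⟩
    ≼ u₁ u₂ ∧ ≼ u₂ u₁              ≤⟨ ≼-antisym u₁ u₂ ⟩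
    ≈ u₁ u₂                        ∎

  ≼-inf-bounds : ⁺-Bounds (IsInf 𝐋 ≼) ≼
  ≼-inf-bounds _ _ _ _ i₁ i₂ = ≤-trans (∧-lb₂ _ _) (inf-mono i₁ i₂)

  ≼-sup-bounds : ⁺-Bounds (IsSup 𝐋 ≼) ≼
  ≼-sup-bounds _ _ _ _ s₁ s₂ = ≤-trans (∧-lb₁ _ _) (sup-mono s₁ s₂)

  ≼-complete : IsCompleteRel 𝐋 ≈ ≼ ≼
  ≼-complete = ≼-compat , ≼-inf-bounds , ≼-sup-bounds

  ≈-complete : IsCompleteRel 𝐋 ≈ ≼ ≈
  ≈-complete = ≈-compat
             , ≼-⁺-Bounds⇒≈-⁺-Bounds ≼-inf-bounds
             , ≼-⁺-Bounds⇒≈-⁺-Bounds ≼-sup-bounds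

-- IsCompleteRel quantifies over given infima and suprema.
theorem9 : {ℓ : Level} (𝐋 : CompleteResiduatedLattice ℓ) {U : Set ℓ}
           (≈ ≼ : LRel 𝐋 U) →
           IsLOrderedSet 𝐋 ≈ ≼ → CompletelyLattice 𝐋 ≼ →
           IsCompleteRel 𝐋 ≈ ≼ ≼ × IsCompleteRel 𝐋 ≈ ≼ ≈
theorem9 𝐋 ≈ ≼ isLOrderedSet _ = ≼-complete , ≈-complete
  where open LOrderedSetProperties 𝐋 ≈ ≼ isLOrderedSet
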